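{- Let $\mathbf{P}=(p_{ij})$ be an instance of makespan minimization on $m$ unrelated machines, and let $T>0$, $L>0$ with $L\le T$. Let $\alpha$ be an assignment of makespan at most $2T$ and average machine load $L$. Let $\gamma\ge 1$ and let $k=|\mathrm{Bad}(\alpha,\gamma)|$. Then (1) $k<\frac{m}{\gamma+1}$; and (2) $|\mathrm{Good}(\alpha,\gamma)|>\left(1-\frac1\gamma\right)m+\frac{k}{\gamma}\cdot\frac{T}{L}$.
   Context: Machines $\mathcal{M}$ ($|\mathcal{M}|=m$), jobs $\mathcal{J}$, processing time $p_{ij}\ge0$ of job $j$ on machine $i$. An assignment is $\alpha:\mathcal{J}\to\mathcal{M}$, load $\delta_i(\alpha)=\sum_{j:\alpha(j)=i}p_{ij}$, makespan $\max_i\delta_i(\alpha)$, average machine load $\frac1m\sum_i\delta_i(\alpha)$. $\mathrm{Bad}(\alpha,\gamma)$ is the set of machines $i$ with $\delta_i(\alpha)>T+\gamma L$, and $\mathrm{Good}(\alpha,\gamma)$ is the set of machines $i$ with $\delta_i(\alpha)\le\gamma L$.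
   Formalization: The processing times $p_{ij}$ and the parameters T, L and γ take values in the rationals. -}

module Defs where

open import Data.Nat using (ℕ)
open import Data.Fin using (Fin; zero; suc; _≟_)
open import Data.List using (List; length; filter)
open import Data.Fin.Base using () renaming (toℕ to finToℕ)
open import Data.List using (allFin)
open import Data.Rational using (ℚ; 0ℚ; _+_; _*_; _<_; _≤_)
open import Data.Rational.Properties using (_<?_; _≤?_)
open import Relation.Nullary.Decidable using (does)
open import Data.Bool using (if_then_else_)

Σℚ : (n : ℕ) → (Fin n → ℚ) → ℚ
Σℚ ℕ.zero    f = 0ℚ
Σℚ (ℕ.suc n) f = f zero + Σℚ n (λ j → f (suc j))

-- An instance: m machines, n jobs, p i j = processing time of job j on machine i.
-- An assignment α : Fin n → Fin m.

load : {m n : ℕ} → (Fin m → Fin n → ℚ) → (Fin n → Fin m) → Fin m → ℚ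
load {m} {n} p α i = Σℚ n (λ j → if does (α j ≟ i) then p i j else 0ℚ)

badCount : {m n : ℕ} → (Fin m → Fin n → ℚ) → (Fin n → Fin m) → (T L γ : ℚ) → ℕ
badCount {m} p α T L γ = length (filter (λ i → (T + γ * L) <? load p α i) (allFin m))

goodCount : {m n : ℕ} → (Fin m → Fin n → ℚ) → (Fin n → Fin m) → (L γ : ℚ) → ℕ
goodCount {m} p α L γ = length (filter (λ i → load p α i ≤? γ * L) (allFin m))

open import Data.Integer using (+_)
open import Data.Rational using (_/_)
ℕ→ℚ : ℕ → ℚ
ℕ→ℚ k = (+ k) / 1

-- Since loads are non-negative, machine by machine (T+γL)·[bad] ≤ load and
-- T·[bad] + γL ≤ load + γL·[good], strictly on every machine with positive load.  The loads
-- add up to mL > 0, so some machine has positive load, and summing gives k(T+γL) < mL and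
-- kT + mγL < mL + gγL; with L ≤ T these rearrange into (1) and (2).
module Submission where

open import Defs
open import Data.Nat using (ℕ; zero; suc)
import Data.Nat as ℕ
import Data.Integer as ℤ
import Data.Integer.Properties as ℤP
import Data.Nat.Coprimality as Coprime
open import Data.Rational
open import Data.Rational.Properties
import Data.Rational.Unnormalised as ℚᵘ
import Data.Rational.Unnormalised.Properties as ℚᵘP
open import Data.Rational.Solver using (module +-*-Solver)
open import Data.Fin using (Fin; zero; suc)
open import Data.List using (length; filter; tabulate)
open import Data.Bool using (true; false; if_then_else_)
open import Data.Product using (_×_; _,_; proj₁; proj₂; ∃)
open import Data.Empty using (⊥-elim)
open import Function using (_∘_; id)
open import Relation.Nullary using (Dec; yes; no; does)
open import Relation.Unary using (Decidable)
open import Relation.Binary.PropositionalEquality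

ℕ→ℚ≡mkℚ : ∀ k → ℕ→ℚ k ≡ mkℚ (ℤ.+ k) 0 (Coprime.sym (Coprime.1-coprimeTo k))
ℕ→ℚ≡mkℚ k = normalize-coprime _

ℕ→ℚ-suc : ∀ k → ℕ→ℚ (suc k) ≡ 1ℚ + ℕ→ℚ k
ℕ→ℚ-suc k rewrite ℕ→ℚ≡mkℚ (suc k) | ℕ→ℚ≡mkℚ k =
  toℚᵘ-injective (ℚᵘP.≃-trans suc≃1+
                                (ℚᵘP.≃-sym (toℚᵘ-homo-+ 1ℚ (mkℚ (ℤ.+ k) 0 (Coprime.sym (Coprime.1-coprimeTo k))))))
  where
  suc≃1+ : ℚᵘ.mkℚᵘ (ℤ.+ suc k) 0 ℚᵘ.≃ ℚᵘ.mkℚᵘ (ℤ.+ 1) 0 ℚᵘ.+ ℚᵘ.mkℚᵘ (ℤ.+ k) 0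
  suc≃1+ = ℚᵘ.*≡* (begin
    ℤ.+ suc k ℤ.* ℤ.1ℤ             ≡⟨ ℤP.*-identityʳ (ℤ.+ suc k) ⟩
    ℤ.1ℤ ℤ.+ ℤ.+ k                 ≡⟨ cong (ℤ._+_ ℤ.1ℤ) (ℤP.*-identityʳ (ℤ.+ k)) ⟨
    ℤ.1ℤ ℤ.+ ℤ.+ k ℤ.* ℤ.1ℤ         ≡⟨ ℤP.*-identityʳ _ ⟨
    (ℤ.1ℤ ℤ.+ ℤ.+ k ℤ.* ℤ.1ℤ) ℤ.* ℤ.1ℤ ∎)
    where open ≡-Reasoning

ℕ→ℚ-suc-* : ∀ k c → ℕ→ℚ (suc k) * c ≡ c + ℕ→ℚ k * c
ℕ→ℚ-suc-* k c rewrite ℕ→ℚ-suc k | *-distribʳ-+ c 1ℚ (ℕ→ℚ k) | *-identityˡ c = refl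

ℕ→ℚ-nonNeg : ∀ k → 0ℚ ≤ ℕ→ℚ k
ℕ→ℚ-nonNeg zero    = ≤-refl
ℕ→ℚ-nonNeg (suc k) rewrite ℕ→ℚ-suc k = +-mono-≤ (<⇒≤ (positive⁻¹ 1ℚ)) (ℕ→ℚ-nonNeg k)

ℕ→ℚ-pos : ∀ {k} → 0 ℕ.< k → 0ℚ < ℕ→ℚ k
ℕ→ℚ-pos {suc k} _ rewrite ℕ→ℚ-suc k = +-mono-<-≤ (positive⁻¹ 1ℚ) (ℕ→ℚ-nonNeg k)

Σℚ-nonNeg : ∀ n {f : Fin n → ℚ} → (∀ i → 0ℚ ≤ f i) → 0ℚ ≤ Σℚ n f
Σℚ-nonNeg zero    f≥0 = ≤-refl
Σℚ-nonNeg (suc n) f≥0 = +-mono-≤ (f≥0 zero) (Σℚ-nonNeg n (f≥0 ∘ suc))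

Σℚ-mono-≤ : ∀ n {f g : Fin n → ℚ} → (∀ i → f i ≤ g i) → Σℚ n f ≤ Σℚ n g
Σℚ-mono-≤ zero    f≤g = ≤-refl
Σℚ-mono-≤ (suc n) f≤g = +-mono-≤ (f≤g zero) (Σℚ-mono-≤ n (f≤g ∘ suc))

Σℚ-mono-< : ∀ n {f g : Fin n → ℚ} → (∀ i → f i ≤ g i) → ∀ i → f i < g i → Σℚ n f < Σℚ n g
Σℚ-mono-< (suc n) f≤g zero    fi<gi = +-mono-<-≤ fi<gi (Σℚ-mono-≤ n (f≤g ∘ suc))
Σℚ-mono-< (suc n) f≤g (suc i) fi<gi = +-mono-≤-< (f≤g zero) (Σℚ-mono-< n (f≤g ∘ suc) i fi<gi)

Σℚ-pos⇒∃pos : ∀ n (f : Fin n → ℚ) → 0ℚ < Σℚ n f → ∃ λ i → 0ℚ < f i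
Σℚ-pos⇒∃pos zero    f 0<0 = ⊥-elim (<-irrefl refl 0<0)
Σℚ-pos⇒∃pos (suc n) f 0<Σ with 0ℚ <? f zero
... | yes 0<f₀ = zero , 0<f₀
... | no  0≮f₀ with Σℚ-pos⇒∃pos n (f ∘ suc) 0<tail
  where
  0<tail : 0ℚ < Σℚ n (f ∘ suc)
  0<tail = <-≤-trans 0<Σ (subst (f zero + Σℚ n (f ∘ suc) ≤_) (+-identityˡ _)
             (+-monoˡ-≤ (Σℚ n (f ∘ suc)) (≮⇒≥ 0≮f₀)))
...   | i , 0<fi = suc i , 0<fi

infix 4 _≤_strictIf0<_

_≤_strictIf0<_ : ℚ → ℚ → ℚ → Set
a ≤ b strictIf0< w = a ≤ b × (0ℚ < w → a < b)

Σℚ-mono-<-onSupport : ∀ n (w : Fin n → ℚ) {f g : Fin n → ℚ} →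
                      (∀ i → f i ≤ g i strictIf0< w i) → 0ℚ < Σℚ n w → Σℚ n f < Σℚ n g
Σℚ-mono-<-onSupport n w f≤g 0<Σw with Σℚ-pos⇒∃pos n w 0<Σw
... | i , 0<wi = Σℚ-mono-< n (proj₁ ∘ f≤g) i (proj₂ (f≤g i) 0<wi)

Σℚ-+ : ∀ n (f g : Fin n → ℚ) → Σℚ n (λ i → f i + g i) ≡ Σℚ n f + Σℚ n g
Σℚ-+ zero    f g = refl
Σℚ-+ (suc n) f g rewrite Σℚ-+ n (f ∘ suc) (g ∘ suc) =
  interchange (f zero) (g zero) (Σℚ n (f ∘ suc)) (Σℚ n (g ∘ suc))
  where
  open +-*-Solver
  interchange : ∀ a b c d → (a + b) + (c + d) ≡ (a + c) + (b + d)
  interchange = solve 4 (λ a b c d → (a :+ b) :+ (c :+ d) := (a :+ c) :+ (b :+ d)) refl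

Σℚ-const : ∀ n c → Σℚ n (λ _ → c) ≡ ℕ→ℚ n * c
Σℚ-const zero    c = sym (*-zeroˡ c)
Σℚ-const (suc n) c = trans (cong (c +_) (Σℚ-const n c)) (sym (ℕ→ℚ-suc-* n c))

infix 5 _when_

_when_ : ∀ {P : Set} → ℚ → Dec P → ℚ
c when P? = if does P? then c else 0ℚ

when-nonNeg : ∀ {P : Set} {c} → 0ℚ ≤ c → (P? : Dec P) → 0ℚ ≤ c when P?
when-nonNeg 0≤c (yes _) = 0≤c
when-nonNeg 0≤c (no  _) = ≤-refl

Σℚ-indicator : ∀ {A : Set} {P : A → Set} (P? : Decidable P) n (g : Fin n → A) c →
               Σℚ n (λ i → c when P? (g i))
               ≡ ℕ→ℚ (length (filter P? (tabulate g))) * c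
Σℚ-indicator P? zero    g c = sym (*-zeroˡ c)
Σℚ-indicator P? (suc n) g c with does (P? (g zero))
... | true  = trans (cong (c +_) (Σℚ-indicator P? n (g ∘ suc) c))
                    (sym (ℕ→ℚ-suc-* (length (filter P? (tabulate (g ∘ suc)))) c))
... | false = trans (+-identityˡ _) (Σℚ-indicator P? n (g ∘ suc) c)

bad-bound : ∀ {c x} → 0ℚ ≤ x → (c<x? : Dec (c < x)) → (c when c<x?) ≤ x strictIf0< x
bad-bound 0≤x (yes c<x) = <⇒≤ c<x , λ _ → c<x
bad-bound 0≤x (no  _)   = 0≤x , λ 0<x → 0<x

bad-good-bound : ∀ {t c x} → 0ℚ < t → 0ℚ ≤ x →
                 (bad? : Dec (t + c < x)) → (good? : Dec (x ≤ c)) →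
                 (t when bad?) + c ≤ x + (c when good?) strictIf0< x
bad-good-bound {t} {c} {x} 0<t 0≤x (yes t+c<x) (yes x≤c) =
  ⊥-elim (<-irrefl refl (<-≤-trans (<-trans c<t+c t+c<x) x≤c))
  where
  c<t+c : c < t + c
  c<t+c = subst (_< t + c) (+-identityˡ c) (+-monoˡ-< c 0<t)
bad-good-bound {x = x} _ _ (yes t+c<x) (no _) rewrite +-identityʳ x =
  <⇒≤ t+c<x , λ _ → t+c<x
bad-good-bound {c = c} _ 0≤x (no _) (yes _) =
  +-monoˡ-≤ c 0≤x , +-monoˡ-< c
bad-good-bound {c = c} {x} _ _ (no _) (no x≰c) rewrite +-identityˡ c | +-identityʳ x =
  <⇒≤ (≰⇒> x≰c) , λ _ → ≰⇒> x≰c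

k[T+γL]<mL⇒k[γ+1]<m : ∀ k m T L γ → 0ℚ ≤ k → 0ℚ < L → L ≤ T →
                       k * (T + γ * L) < m * L → k * (γ + 1ℚ) < m
k[T+γL]<mL⇒k[γ+1]<m k m T L γ 0≤k 0<L L≤T k[T+γL]<mL =
  *-cancelʳ-<-nonNeg L {{nonNegative (<⇒≤ 0<L)}} (begin-strict
    k * (γ + 1ℚ) * L ≡⟨ distrib k γ L ⟩
    k * (L + γ * L)  ≤⟨ *-monoˡ-≤-nonNeg k {{nonNegative 0≤k}} (+-monoˡ-≤ (γ * L) L≤T) ⟩
    k * (T + γ * L)  <⟨ k[T+γL]<mL ⟩
    m * L            ∎)
  where
  open ≤-Reasoning
  open +-*-Solver
  distrib : ∀ k γ L → k * (γ + 1ℚ) * L ≡ k * (L + γ * L)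
  distrib = solve 3 (λ k γ L → k :* (γ :+ con 1ℚ) :* L := k :* (L :+ γ :* L)) refl

kT+mγL<mL+gγL⇒[γ-1]mL+kT<γLg : ∀ k m g T L γ →
  k * T + m * (γ * L) < m * L + g * (γ * L) → ((γ - 1ℚ) * m) * L + k * T < (γ * L) * g
kT+mγL<mL+gγL⇒[γ-1]mL+kT<γLg k m g T L γ lt =
  subst₂ _<_ (lhs k T m γ L) (rhs m L g γ) (+-monoˡ-< (- (m * L)) lt)
  where
  open +-*-Solver
  lhs : ∀ k T m γ L → (k * T + m * (γ * L)) - m * L ≡ ((γ - 1ℚ) * m) * L + k * T
  lhs = solve 5 (λ k T m γ L → (k :* T :+ m :* (γ :* L)) :- m :* L
                               := ((γ :- con 1ℚ) :* m) :* L :+ k :* T) refl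
  rhs : ∀ m L g γ → (m * L + g * (γ * L)) - m * L ≡ (γ * L) * g
  rhs = solve 4 (λ m L g γ → (m :* L :+ g :* (γ :* L)) :- m :* L := (γ :* L) :* g) refl

lemma2 : (m n : ℕ) → (p : Fin m → Fin n → ℚ) → (∀ i j → 0ℚ ≤ p i j)
    → (T L : ℚ) → 0ℚ < T → 0ℚ < L → L ≤ T
    → (α : Fin n → Fin m)
    → (∀ i → load p α i ≤ ℕ→ℚ 2 * T)
    → 1 Data.Nat.≤ m
    → Σℚ m (load p α) ≡ ℕ→ℚ m * L
    → (γ : ℚ) → 1ℚ ≤ γ
    → (ℕ→ℚ (badCount p α T L γ) * (γ + 1ℚ) < ℕ→ℚ m)
      × ((((γ - 1ℚ) * ℕ→ℚ m) * L + ℕ→ℚ (badCount p α T L γ) * T)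
          < (γ * L) * ℕ→ℚ (goodCount p α L γ))
lemma2 m n p p≥0 T L 0<T 0<L L≤T α _ 0<m Σx≡mL γ _ =
  k[T+γL]<mL⇒k[γ+1]<m (ℕ→ℚ k) (ℕ→ℚ m) T L γ (ℕ→ℚ-nonNeg k) 0<L L≤T (begin-strict
    ℕ→ℚ k * (T + γ * L)                      ≡⟨ Σℚ-indicator bad? m id (T + γ * L) ⟨
    Σℚ m (λ i → (T + γ * L) when bad? i)     <⟨ Σℚ-mono-<-onSupport m x (λ i → bad-bound (0≤x i) (bad? i)) 0<Σx ⟩
    Σℚ m x                                    ≡⟨ Σx≡mL ⟩
    ℕ→ℚ m * L                                 ∎)
  , kT+mγL<mL+gγL⇒[γ-1]mL+kT<γLg (ℕ→ℚ k) (ℕ→ℚ m) (ℕ→ℚ g) T L γ (begin-strict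
    ℕ→ℚ k * T + ℕ→ℚ m * (γ * L)              ≡⟨ cong₂ _+_ (Σℚ-indicator bad? m id T) (Σℚ-const m (γ * L)) ⟨
    Σℚ m (λ i → T when bad? i) + Σℚ m (λ _ → γ * L)
                                              ≡⟨ Σℚ-+ m (λ i → T when bad? i) (λ _ → γ * L) ⟨
    Σℚ m (λ i → (T when bad? i) + γ * L)      <⟨ Σℚ-mono-<-onSupport m x
                                                   (λ i → bad-good-bound 0<T (0≤x i) (bad? i) (good? i)) 0<Σx ⟩
    Σℚ m (λ i → x i + (γ * L when good? i))   ≡⟨ Σℚ-+ m x (λ i → γ * L when good? i) ⟩
    Σℚ m x + Σℚ m (λ i → γ * L when good? i)  ≡⟨ cong₂ _+_ Σx≡mL (Σℚ-indicator good? m id (γ * L)) ⟩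
    ℕ→ℚ m * L + ℕ→ℚ g * (γ * L)               ∎)
  where
  open ≤-Reasoning
  x : Fin m → ℚ
  x = load p α
  bad? : ∀ i → Dec (T + γ * L < x i)
  bad? i = T + γ * L <? x i
  good? : ∀ i → Dec (x i ≤ γ * L)
  good? i = x i ≤? γ * L
  k g : ℕ
  k = badCount p α T L γ
  g = goodCount p α L γ
  0≤x : ∀ i → 0ℚ ≤ x i
  0≤x i = Σℚ-nonNeg n (λ j → when-nonNeg (p≥0 i j) (α j Data.Fin.≟ i))
  0<Σx : 0ℚ < Σℚ m x
  0<Σx = subst (0ℚ <_) (sym Σx≡mL)
    (positive⁻¹ _ {{pos*pos⇒pos (ℕ→ℚ m) {{positive (ℕ→ℚ-pos 0<m)}} L {{positive 0<L}}}})
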